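{- Work in intuitionistic, predicative mathematics with countable choice ($AC_\omega$) but without the law of excluded middle. Let $L$ be an overt $\sigma$-locale with positivity predicate $Pos$. Then the relation $x\approx y$ defined by $$\forall z\in L.\,[Pos(x\wedge z)\Leftrightarrow Pos(y\wedge z)]$$ is a congruence on $L$, and the quotient $B(L)=L/\approx$ is a $\sigma$-overlap algebra (with positivity predicate $Pos([x])$ iff $Pos(x)$).
   Context: A $\sigma$-frame is a partial order (whose carrier is a set) with countable joins and finite meets in which binary meets distribute over countable joins; a $\sigma$-locale is a $\sigma$-frame regarded in the opposite category. A set $W$ is countable if there is $\alpha:\mathbb{N}\to W+\{*\}$ with $W\subseteq\alpha[\mathbb{N}]$. A congruence on a $\sigma$-frame $L$ is an equivalence relation compatible with finite meets and countable joins (so the quotient is a $\sigma$-frame). A $\sigma$-frame $L$ is overt if there is a predicate $Pos$ on $L$ such that: (1) if $a\leq b$ and $Pos(a)$ then $Pos(b)$; (2) if $Pos(\bigvee W)$ for a countable $W$, then $Pos(a)$ for some $a\in W$; (3) for every $a$ there is a countable $W\subseteq\{a\}$ with $a=\bigvee W$ and $Pos(b)$ for all $b\in W$. A $\sigma$-overlap algebra is an overt $\sigma$-frame such that for all $x,y$: if $\forall z.[Pos(x\wedge z)\Rightarrow Pos(y\wedge z)]$ then $x\leq y$. -}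

module Defs where

open import Level using (Level; _⊔_; suc)
open import Data.Nat using (ℕ)
open import Data.Maybe using (Maybe; just; nothing; map)
open import Data.Product using (Σ; ∃; _×_; _,_)
open import Relation.Binary.PropositionalEquality using (_≡_)
open import Relation.Binary.Core using (Rel)
open import Relation.Binary.Structures using (IsEquivalence; IsPartialOrder)
open import Data.Maybe.Relation.Binary.Pointwise using (Pointwise)

-- A countable subset W of a carrier C is presented by an enumeration
-- α : ℕ → Maybe C  (Maybe C = C + {*}); its elements are the a with α n ≡ just a.
Seq : ∀ {c} → Set c → Set c
Seq C = ℕ → Maybe C

_∈ₛ_ : ∀ {c} {C : Set c} → C → Seq C → Set c
a ∈ₛ s = ∃ λ n → s n ≡ just a

record IsSigmaFrame {c ℓ₁ ℓ₂} {C : Set c} (_≈_ : Rel C ℓ₁) (_≤_ : Rel C ℓ₂)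
                    (⊤ : C) (_∧_ : C → C → C) (⋁ : Seq C → C)
                    : Set (c ⊔ ℓ₁ ⊔ ℓ₂) where
  field
    isPartialOrder : IsPartialOrder _≈_ _≤_
    ⊤-max   : ∀ x → x ≤ ⊤
    ∧-lowerˡ : ∀ x y → (x ∧ y) ≤ x
    ∧-lowerʳ : ∀ x y → (x ∧ y) ≤ y
    ∧-glb   : ∀ x y z → z ≤ x → z ≤ y → z ≤ (x ∧ y)
    ⋁-upper : ∀ s a → a ∈ₛ s → a ≤ ⋁ s
    ⋁-least : ∀ s b → (∀ a → a ∈ₛ s → a ≤ b) → ⋁ s ≤ b
    distrib : ∀ x s → (x ∧ ⋁ s) ≈ ⋁ (λ n → map (x ∧_) (s n))

record SigmaFrame c ℓ₁ ℓ₂ : Set (suc (c ⊔ ℓ₁ ⊔ ℓ₂)) where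
  field
    Carrier : Set c
    _≈_ : Rel Carrier ℓ₁
    _≤_ : Rel Carrier ℓ₂
    ⊤ : Carrier
    _∧_ : Carrier → Carrier → Carrier
    ⋁ : Seq Carrier → Carrier
    isSigmaFrame : IsSigmaFrame _≈_ _≤_ ⊤ _∧_ ⋁
  open IsSigmaFrame isSigmaFrame public

record IsOvert {c ℓ₁ ℓ₂ ℓ₃} {C : Set c} (_≈_ : Rel C ℓ₁) (_≤_ : Rel C ℓ₂)
               (⋁ : Seq C → C) (Pos : C → Set ℓ₃)
               : Set (c ⊔ ℓ₁ ⊔ ℓ₂ ⊔ ℓ₃) where
  field
    Pos-mono : ∀ a b → a ≤ b → Pos a → Pos b
    Pos-⋁    : ∀ s → Pos (⋁ s) → ∃ λ a → a ∈ₛ s × Pos a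
    Pos-cover : ∀ a → Σ (Seq C) λ s →
                  (∀ b → b ∈ₛ s → b ≈ a) × (a ≈ ⋁ s) × (∀ b → b ∈ₛ s → Pos b)

record IsSigmaOverlapAlgebra {c ℓ₁ ℓ₂ ℓ₃} {C : Set c} (_≈_ : Rel C ℓ₁) (_≤_ : Rel C ℓ₂)
               (⊤ : C) (_∧_ : C → C → C) (⋁ : Seq C → C) (Pos : C → Set ℓ₃)
               : Set (c ⊔ ℓ₁ ⊔ ℓ₂ ⊔ ℓ₃) where
  field
    isSigmaFrame : IsSigmaFrame _≈_ _≤_ ⊤ _∧_ ⋁
    isOvert      : IsOvert _≈_ _≤_ ⋁ Pos
    overlapAx    : ∀ x y → (∀ z → Pos (x ∧ z) → Pos (y ∧ z)) → x ≤ y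

record IsCongruence {c ℓ₁ ℓ₂ ℓ} (L : SigmaFrame c ℓ₁ ℓ₂)
                    (_~_ : Rel (SigmaFrame.Carrier L) ℓ)
                    : Set (c ⊔ ℓ₁ ⊔ ℓ) where
  open SigmaFrame L
  field
    isEquivalence : IsEquivalence _~_
    ≈⇒~    : ∀ {x y} → x ≈ y → x ~ y
    ⊤-cong : ⊤ ~ ⊤
    ∧-cong : ∀ {x x' y y'} → x ~ x' → y ~ y' → (x ∧ y) ~ (x' ∧ y')
    ⋁-cong : ∀ {s t} → (∀ n → Pointwise _~_ (s n) (t n)) → ⋁ s ~ ⋁ t

module _ {c ℓ₁ ℓ₂ ℓ₃} (L : SigmaFrame c ℓ₁ ℓ₂) (Pos : SigmaFrame.Carrier L → Set ℓ₃) where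
  open SigmaFrame L

  _≈ᴮ_ : Rel Carrier (c ⊔ ℓ₃)
  x ≈ᴮ y = ∀ z → (Pos (x ∧ z) → Pos (y ∧ z)) × (Pos (y ∧ z) → Pos (x ∧ z))

  -- order on the quotient B(L) = L/≈ᴮ : [x] ≤ [y] iff x ∧ y ≈ᴮ x
  _≤ᴮ_ : Rel Carrier (c ⊔ ℓ₃)
  x ≤ᴮ y = (x ∧ y) ≈ᴮ x

-- Pos(x ∧ z) ⇒ Pos(y ∧ z) for all z defines a preorder x ≼ y on L whose symmetric
-- part is ≈ᴮ.  It is monotone in ∧ (associativity moves the test element z across),
-- and ⋁ s ≼ b as soon as every a ∈ s satisfies a ≼ b, because by distributivity and
-- overtness a positive ⋁ s ∧ z has a positive component a ∧ z.  Hence ≈ᴮ is a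
-- congruence and [x] ≤ [y] holds exactly when x ≼ y; the overlap axiom of B(L)
-- is then the definition of ≼.
module Submission where

open import Defs
open import Level using (_⊔_)
open import Function using (_∘_)
open import Data.Product using (_×_; _,_; proj₁; proj₂; ∃)
open import Data.Maybe using (just; map)
open import Data.Maybe.Properties using (just-injective)
import Data.Maybe.Relation.Binary.Pointwise as Pointwise
open Pointwise using (Pointwise; just-inv)
open import Relation.Binary.Core using (Rel)
open import Relation.Binary.Lattice using (MeetSemilattice)
open import Relation.Binary.PropositionalEquality using (_≡_; refl; subst)
open import Relation.Binary.Structures using (IsEquivalence; IsPartialOrder)
import Relation.Binary.Lattice.Properties.MeetSemilattice as MeetSemilatticeProperties

∈ₛ-map⁻ : ∀ {a b} {A : Set a} {B : Set b} {f : A → B} {s : Seq A} {y : B} →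
          y ∈ₛ (λ n → map f (s n)) → ∃ λ x → x ∈ₛ s × f x ≡ y
∈ₛ-map⁻ {s = s} (n , fsn≡y) with s n in sn≡x
... | just x = x , (n , sn≡x) , just-injective fsn≡y

meetSemilattice : ∀ {c ℓ₁ ℓ₂} → SigmaFrame c ℓ₁ ℓ₂ → MeetSemilattice c ℓ₁ ℓ₂
meetSemilattice L = record
  { isMeetSemilattice = record
    { isPartialOrder = isPartialOrder
    ; infimum        = λ x y → ∧-lowerˡ x y , ∧-lowerʳ x y , ∧-glb x y
    }
  }
  where open SigmaFrame L

module OvertSigmaFrame {c ℓ₁ ℓ₂ ℓ₃} (L : SigmaFrame c ℓ₁ ℓ₂)
                       (Pos : SigmaFrame.Carrier L → Set ℓ₃)
                       (overt : IsOvert (SigmaFrame._≈_ L) (SigmaFrame._≤_ L) (SigmaFrame.⋁ L) Pos)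
                       where
  open SigmaFrame L
  open IsPartialOrder isPartialOrder using (reflexive; trans; module Eq)
  open MeetSemilatticeProperties (meetSemilattice L) using (∧-assoc; ∧-comm; ∧-idempotent)
  open IsOvert overt

  infix 4 _≼_ _≋_ _⊑_

  _≋_ : Rel Carrier (c ⊔ ℓ₃)
  _≋_ = _≈ᴮ_ L Pos

  _⊑_ : Rel Carrier (c ⊔ ℓ₃)
  _⊑_ = _≤ᴮ_ L Pos

  _≼_ : Rel Carrier (c ⊔ ℓ₃)
  x ≼ y = ∀ z → Pos (x ∧ z) → Pos (y ∧ z)

  Pos-resp-≤ : ∀ {x y} → x ≤ y → Pos x → Pos y
  Pos-resp-≤ = Pos-mono _ _

  Pos-resp-≈ : ∀ {x y} → x ≈ y → Pos x → Pos y
  Pos-resp-≈ = Pos-resp-≤ ∘ reflexive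

  ≤⇒≼ : ∀ {x y} → x ≤ y → x ≼ y
  ≤⇒≼ {x} {y} x≤y z = Pos-resp-≤ (∧-glb y z (x ∧ z) (trans (∧-lowerˡ x z) x≤y) (∧-lowerʳ x z))

  ≈⇒≼ : ∀ {x y} → x ≈ y → x ≼ y
  ≈⇒≼ = ≤⇒≼ ∘ reflexive

  ≼-refl : ∀ {x} → x ≼ x
  ≼-refl z = λ p → p

  ≼-trans : ∀ {x y w} → x ≼ y → y ≼ w → x ≼ w
  ≼-trans x≼y y≼w z = y≼w z ∘ x≼y z

  ≼-Pos : ∀ {x y} → x ≼ y → Pos x → Pos y
  ≼-Pos {x} {y} x≼y =
    Pos-resp-≤ (∧-lowerˡ y ⊤) ∘ x≼y ⊤ ∘ Pos-resp-≤ (∧-glb x ⊤ x (reflexive Eq.refl) (⊤-max x))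

  ∧-monoˡ-≼ : ∀ {x x'} y → x ≼ x' → x ∧ y ≼ x' ∧ y
  ∧-monoˡ-≼ {x} {x'} y x≼x' z =
    Pos-resp-≈ (Eq.sym (∧-assoc x' y z)) ∘ x≼x' (y ∧ z) ∘ Pos-resp-≈ (∧-assoc x y z)

  ∧-mono-≼ : ∀ {x x' y y'} → x ≼ x' → y ≼ y' → x ∧ y ≼ x' ∧ y'
  ∧-mono-≼ {x} {x'} {y} {y'} x≼x' y≼y' =
    ≼-trans (∧-monoˡ-≼ y x≼x')
      (≼-trans (≈⇒≼ (∧-comm x' y))
        (≼-trans (∧-monoˡ-≼ x' y≼y') (≈⇒≼ (∧-comm y' x'))))

  ∧-greatest-≼ : ∀ {x y w} → w ≼ x → w ≼ y → w ≼ x ∧ y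
  ∧-greatest-≼ {w = w} w≼x w≼y = ≼-trans (≈⇒≼ (Eq.sym (∧-idempotent w))) (∧-mono-≼ w≼x w≼y)

  Pos-⋁-∧ : ∀ s z → Pos (⋁ s ∧ z) → ∃ λ x → x ∈ₛ s × Pos (x ∧ z)
  Pos-⋁-∧ s z p with Pos-⋁ _ (Pos-resp-≈ (Eq.trans (∧-comm (⋁ s) z) (distrib z s)) p)
  ... | _ , z∧x∈ , pos with ∈ₛ-map⁻ {f = z ∧_} z∧x∈
  ...   | x , x∈s , refl = x , x∈s , Pos-resp-≈ (∧-comm z x) pos

  ⋁-least-≼ : ∀ s b → (∀ x → x ∈ₛ s → x ≼ b) → ⋁ s ≼ b
  ⋁-least-≼ s b bound z p with Pos-⋁-∧ s z p
  ... | x , x∈s , pos = bound x x∈s z pos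

  ⋁-mono-≼ : ∀ {s t} → (∀ n → Pointwise _≼_ (s n) (t n)) → ⋁ s ≼ ⋁ t
  ⋁-mono-≼ {s} {t} s≼t = ⋁-least-≼ s (⋁ t) below
    where
    below : ∀ x → x ∈ₛ s → x ≼ ⋁ t
    below x (n , sn≡x) with just-inv (subst (λ m → Pointwise _≼_ m (t n)) sn≡x (s≼t n))
    ... | y , tn≡y , x≼y = ≼-trans x≼y (≤⇒≼ (⋁-upper t y (n , tn≡y)))

  ≋-intro : ∀ {x y} → x ≼ y → y ≼ x → x ≋ y
  ≋-intro x≼y y≼x z = x≼y z , y≼x z

  ≋⇒≼ : ∀ {x y} → x ≋ y → x ≼ y
  ≋⇒≼ x≋y z = proj₁ (x≋y z)

  ≋⇒≽ : ∀ {x y} → x ≋ y → y ≼ x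
  ≋⇒≽ x≋y z = proj₂ (x≋y z)

  ≋-isEquivalence : IsEquivalence _≋_
  ≋-isEquivalence = record
    { refl  = ≋-intro ≼-refl ≼-refl
    ; sym   = λ x≋y → ≋-intro (≋⇒≽ x≋y) (≋⇒≼ x≋y)
    ; trans = λ x≋y y≋w → ≋-intro (≼-trans (≋⇒≼ x≋y) (≋⇒≼ y≋w)) (≼-trans (≋⇒≽ y≋w) (≋⇒≽ x≋y))
    }

  ≋-sym : ∀ {x y} → x ≋ y → y ≋ x
  ≋-sym = IsEquivalence.sym ≋-isEquivalence

  ⋁-cong-≋ : ∀ {s t} → (∀ n → Pointwise _≋_ (s n) (t n)) → ⋁ s ≋ ⋁ t
  ⋁-cong-≋ s≋t = ≋-intro (⋁-mono-≼ (Pointwise.sym ≋⇒≽ ∘ Pointwise.sym ≋-sym ∘ s≋t))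
                         (⋁-mono-≼ (Pointwise.sym ≋⇒≽ ∘ s≋t))

  ⊑⇒≼ : ∀ {x y} → x ⊑ y → x ≼ y
  ⊑⇒≼ {x} {y} x⊑y = ≼-trans (≋⇒≽ x⊑y) (≤⇒≼ (∧-lowerʳ x y))

  ≼⇒⊑ : ∀ {x y} → x ≼ y → x ⊑ y
  ≼⇒⊑ {x} {y} x≼y = ≋-intro (≤⇒≼ (∧-lowerˡ x y)) (∧-greatest-≼ ≼-refl x≼y)

  ≈⇒≋ : ∀ {x y} → x ≈ y → x ≋ y
  ≈⇒≋ x≈y = ≋-intro (≈⇒≼ x≈y) (≈⇒≼ (Eq.sym x≈y))

  isCongruence : IsCongruence L _≋_
  isCongruence = record
    { isEquivalence = ≋-isEquivalence
    ; ≈⇒~    = ≈⇒≋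
    ; ⊤-cong = IsEquivalence.refl ≋-isEquivalence
    ; ∧-cong = λ x≋x' y≋y' → ≋-intro (∧-mono-≼ (≋⇒≼ x≋x') (≋⇒≼ y≋y'))
                                    (∧-mono-≼ (≋⇒≽ x≋x') (≋⇒≽ y≋y'))
    ; ⋁-cong = ⋁-cong-≋
    }

  ⊑-isPartialOrder : IsPartialOrder _≋_ _⊑_
  ⊑-isPartialOrder = record
    { isPreorder = record
      { isEquivalence = ≋-isEquivalence
      ; reflexive     = ≼⇒⊑ ∘ ≋⇒≼
      ; trans         = λ x⊑y y⊑w → ≼⇒⊑ (≼-trans (⊑⇒≼ x⊑y) (⊑⇒≼ y⊑w))
      }
    ; antisym = λ x⊑y y⊑x → ≋-intro (⊑⇒≼ x⊑y) (⊑⇒≼ y⊑x)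
    }

  quotientIsSigmaFrame : IsSigmaFrame _≋_ _⊑_ ⊤ _∧_ ⋁
  quotientIsSigmaFrame = record
    { isPartialOrder = ⊑-isPartialOrder
    ; ⊤-max    = λ x → ≤⇒⊑ (⊤-max x)
    ; ∧-lowerˡ = λ x y → ≤⇒⊑ (∧-lowerˡ x y)
    ; ∧-lowerʳ = λ x y → ≤⇒⊑ (∧-lowerʳ x y)
    ; ∧-glb    = λ x y w w⊑x w⊑y → ≼⇒⊑ (∧-greatest-≼ (⊑⇒≼ w⊑x) (⊑⇒≼ w⊑y))
    ; ⋁-upper  = λ s x x∈s → ≤⇒⊑ (⋁-upper s x x∈s)
    ; ⋁-least  = λ s b bound → ≼⇒⊑ (⋁-least-≼ s b (λ x x∈s → ⊑⇒≼ (bound x x∈s)))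
    ; distrib  = λ x s → ≈⇒≋ (distrib x s)
    }
    where
    ≤⇒⊑ : ∀ {x y} → x ≤ y → x ⊑ y
    ≤⇒⊑ = ≼⇒⊑ ∘ ≤⇒≼

  quotientIsOvert : IsOvert _≋_ _⊑_ ⋁ Pos
  quotientIsOvert = record
    { Pos-mono  = λ x y x⊑y → ≼-Pos (⊑⇒≼ x⊑y)
    ; Pos-⋁     = Pos-⋁
    ; Pos-cover = λ x → let s , s≈x , x≈⋁s , s⁺ = Pos-cover x
                        in s , (λ y y∈s → ≈⇒≋ (s≈x y y∈s)) , ≈⇒≋ x≈⋁s , s⁺
    }

  quotientIsSigmaOverlapAlgebra : IsSigmaOverlapAlgebra _≋_ _⊑_ ⊤ _∧_ ⋁ Pos
  quotientIsSigmaOverlapAlgebra = record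
    { isSigmaFrame = quotientIsSigmaFrame
    ; isOvert      = quotientIsOvert
    ; overlapAx    = λ x y → ≼⇒⊑
    }

mainTheorem8 : ∀ {c ℓ₁ ℓ₂ ℓ₃} (L : SigmaFrame c ℓ₁ ℓ₂) (Pos : SigmaFrame.Carrier L → Set ℓ₃)
    → IsOvert (SigmaFrame._≈_ L) (SigmaFrame._≤_ L) (SigmaFrame.⋁ L) Pos
    → IsCongruence L (_≈ᴮ_ L Pos)
      × IsSigmaOverlapAlgebra (_≈ᴮ_ L Pos) (_≤ᴮ_ L Pos)
          (SigmaFrame.⊤ L) (SigmaFrame._∧_ L) (SigmaFrame.⋁ L) Pos
mainTheorem8 L Pos overt = isCongruence , quotientIsSigmaOverlapAlgebra
  where open OvertSigmaFrame L Pos overt
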